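{- Let $P(x,y)=\sum_{\pi}x^{|\pi|}y^{\mathrm{rises}(\pi)}$, the sum over all Dumont permutations $\pi$ (of all lengths, including the empty one) avoiding $132$. Then $$P(x,y)=\frac{1+xy-2x^2y+2x^2y^2-(1+xy)\sqrt{1-4x^2y}}{2x^2y^2}.$$ Equivalently, the generating function $\sum_n c_{n,k}x^n$, where $c_{n,k}$ is the number of $132$-avoiding Dumont permutations of length $n$ with exactly $k$ rises, equals $C_kx^{2k+1}+C_{k+1}x^{2k+2}$ for every $k\geq1$, and equals $1+x+x^2$ for $k=0$.
   Context: A permutation $\pi=\pi_1\cdots\pi_n\in S_n$ is a Dumont permutation (of the first kind) if every even entry $\pi_i$ is followed by a smaller entry ($i<n$ and $\pi_{i+1}<\pi_i$) and every odd entry $\pi_i$ is either last ($i=n$) or followed by a larger entry; the empty permutation is a Dumont permutation. $\pi$ avoids $132$ if there are no $i<j<l$ with $\pi_i<\pi_l<\pi_j$. $|\pi|$ is the length of $\pi$; a rise of $\pi$ is an index $j\in\{1,\dots,n-1\}$ with $\pi_j<\pi_{j+1}$, and $\mathrm{rises}(\pi)$ is the number of rises. $C_m=\frac1{m+1}\binom{2m}{m}$ is the $m$th Catalan number. -}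

module Defs where

open import Data.Nat using (ℕ; zero; suc; _+_; _*_; _<_; _<ᵇ_; _/_)
open import Data.Nat.Divisibility using (_∣_)
open import Data.Nat.Combinatorics using (_C_)
open import Data.Fin as Fin using (Fin; toℕ)
open import Data.Vec using (Vec; lookup; toList; map)
open import Data.List using (List; []; _∷_)
open import Data.Bool using (if_then_else_)
open import Data.Product using (Σ; ∃; _×_)
open import Data.Sum using (_⊎_)
open import Relation.Nullary using (¬_)
open import Relation.Binary.PropositionalEquality using (_≡_)

-- A permutation of length n is a vector v of entries in Fin n whose
-- lookup is injective; the i-th entry (1-based value) is  val v i = toℕ (lookup v i) + 1.
IsPerm : ∀ {n} → Vec (Fin n) n → Set
IsPerm {n} v = ∀ (i j : Fin n) → lookup v i ≡ lookup v j → i ≡ j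

val : ∀ {n} → Vec (Fin n) n → Fin n → ℕ
val v i = suc (toℕ (lookup v i))

Even : ℕ → Set
Even m = 2 ∣ m

IsDumont : ∀ {n} → Vec (Fin n) n → Set
IsDumont {n} v = ∀ (i : Fin n) →
  (Even (val v i) → Σ (Fin n) λ j → (toℕ j ≡ suc (toℕ i)) × (val v j < val v i))
  × (¬ Even (val v i) → (suc (toℕ i) ≡ n)
       ⊎ Σ (Fin n) λ j → (toℕ j ≡ suc (toℕ i)) × (val v i < val v j))

Avoids132 : ∀ {n} → Vec (Fin n) n → Set
Avoids132 {n} v = ∀ (i j l : Fin n) → i Fin.< j → j Fin.< l →
  ¬ ((val v i < val v l) × (val v l < val v j))

risesL : List ℕ → ℕ
risesL [] = 0
risesL (a ∷ []) = 0
risesL (a ∷ b ∷ xs) = (if a <ᵇ b then 1 else 0) + risesL (b ∷ xs)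

rises : ∀ {n} → Vec (Fin n) n → ℕ
rises {n} v = risesL (toList (map (λ x → suc (toN x)) v))
  where toN : Fin n → ℕ
        toN = toℕ

-- 132-avoiding Dumont permutations of length n with exactly k rises.
-- Proof fields are irrelevant, so two elements are equal iff their vectors are.
record DP (n k : ℕ) : Set where
  constructor dp
  field
    perm : Vec (Fin n) n
    .isPerm : IsPerm perm
    .isDumont : IsDumont perm
    .avoids : Avoids132 perm
    .nrises : rises perm ≡ k

catalan : ℕ → ℕ
catalan m = ((2 * m) C m) / suc m

{-# OPTIONS --safe #-}
module Submission where

-- In a 132-avoiding permutation α n β of 1, …, n every entry of α exceeds every entry of β, so β is
-- a 132-avoiding permutation of 1, …, |β| and α one of |β| + 1, …, n − 1; conversely any two such
-- permutations glue back. For Dumont permutations the parity of n decides the shape: odd n must come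
-- last (β empty), even n must be followed by a smaller entry (β nonempty), and if α is nonempty then
-- |β| is even, since otherwise |β| + 1 would be an even entry of α followed only by larger ones.
-- Hence the numbers d(n) of 132-avoiding Dumont permutations satisfy d(2m + 1) = d(2m) and
-- d(2m + 2) = Σ_{j+k=m} d(2j) d(2k), the Catalan recurrence. Finally, in a Dumont permutation the
-- last entry is odd, every other odd entry starts a rise and every even entry a descent, so there
-- are exactly ⌈n/2⌉ − 1 rises.

open import Defs
open import Data.Nat using (ℕ; suc; _+_; _*_; _≤_; _<_)
open import Data.Fin using (Fin)
open import Data.Product using (_×_)
open import Function.Bundles using (_↔_)
open import Relation.Binary.PropositionalEquality using (_≢_)

open import Data.Bool using (true; false; if_then_else_)
open import Data.Bool.Properties using (T-≡)
open import Data.Empty using (⊥; ⊥-elim)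
import Data.Empty.Irrelevant as Irr
open import Data.Fin using (toℕ; fromℕ<) renaming (zero to fzero; suc to fsuc)
import Data.Fin as Fin
import Data.Fin.Properties as Fin
open import Data.Fin.Properties using (+↔⊎)
open import Data.List using (List; []; _∷_; _++_; map; length; tabulate)
open import Data.List.Properties
  using (≡-dec; ∷-injectiveˡ; ∷-injectiveʳ; map-injective; length-++; length-++-sucʳ; length-map; map-++; ++-assoc)
open import Data.List.Membership.Propositional using (_∈_)
open import Data.List.Membership.Propositional.Properties using (∈-∃++)
open import Data.List.Relation.Unary.All as All using (All; []; _∷_)
import Data.List.Relation.Unary.All.Properties as All
open import Data.List.Relation.Unary.AllPairs as AllPairs using (AllPairs; []; _∷_)
import Data.List.Relation.Unary.AllPairs.Properties as AllPairs
open import Data.List.Relation.Unary.Unique.Propositional using (Unique)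
import Data.List.Relation.Unary.Unique.Propositional.Properties as Unique
open import Data.Nat
open import Data.Nat.Combinatorics using (_C_; nCk+nC[k+1]≡[n+1]C[k+1]; nCk≡nC[n∸k]; nC1≡n)
open import Data.Nat.Divisibility using (divides)
open import Data.Nat.DivMod using (m*n/n≡m)
open import Data.Nat.ListAction using (sum)
open import Data.Nat.ListAction.Properties using (sum-++)
open import Data.Nat.Properties
open import Data.List.Membership.DecPropositional _≟_ using (_∈?_)
open import Data.Nat.Tactic.RingSolver using (solve-∀)
open import Data.Parity.Base using (Parity; 0ℙ; 1ℙ)
import Data.Parity.Base as ℙ
import Data.Parity.Properties as ℙ
open import Data.Product using (Σ; ∃; _,_; proj₁; proj₂)
open import Data.Sum using (_⊎_; inj₁; inj₂)
import Data.Sum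
open import Data.Sum.Function.Propositional using (_⊎-↔_)
open import Data.Unit using (⊤; tt)
open import Data.Vec using (Vec; []; _∷_)
import Data.Vec as Vec
open import Function using (_∘_)
open import Function.Bundles using (mk⤖; mk↔ₛ′; Inverse; Equivalence)
open import Function.Consequences.Propositional using (strictlySurjective⇒surjective)
open import Function.Properties.Bijection using (⤖⇒↔)
open import Function.Properties.Inverse using (↔-trans; ↔-sym)
open import Relation.Binary.Definitions using (tri<; tri≈; tri>)
open import Relation.Binary.PropositionalEquality
open import Relation.Nullary using (¬_; yes; no)
open import Relation.Nullary.Decidable using (recompute)

double : ℕ → ℕ
double zero = zero
double (suc n) = suc (suc (double n))

even-or-odd : ∀ n → (∃ λ j → n ≡ double j) ⊎ (∃ λ j → n ≡ suc (double j))
even-or-odd zero = inj₁ (zero , refl)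
even-or-odd (suc zero) = inj₂ (zero , refl)
even-or-odd (suc (suc n)) with even-or-odd n
... | inj₁ (j , refl) = inj₁ (suc j , refl)
... | inj₂ (j , refl) = inj₂ (suc j , refl)

double-+ : ∀ m n → double (m + n) ≡ double m + double n
double-+ zero n = refl
double-+ (suc m) n = cong (suc ∘ suc) (double-+ m n)

parity-cases : ∀ x → parity x ≡ 0ℙ ⊎ parity x ≡ 1ℙ
parity-cases x with parity x
... | 0ℙ = inj₁ refl
... | 1ℙ = inj₂ refl

0ℙ≢1ℙ : 0ℙ ≢ 1ℙ
0ℙ≢1ℙ ()

parity-double : ∀ n → parity (double n) ≡ 0ℙ
parity-double zero = refl
parity-double (suc n) = parity-double n

parity-suc-double : ∀ n → parity (suc (double n)) ≡ 1ℙ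
parity-suc-double zero = refl
parity-suc-double (suc n) = parity-suc-double n

parity-+-even : ∀ m {b} → parity b ≡ 0ℙ → parity (m + b) ≡ parity m
parity-+-even m {b} pb = trans (ℙ.+-homo-+ m b) (trans (cong (parity m ℙ.+_) pb) (ℙ.+-identityʳ (parity m)))

double≡2* : ∀ n → double n ≡ 2 * n
double≡2* zero = refl
double≡2* (suc n) = cong suc (trans (cong suc (double≡2* n)) (sym (+-suc n (n + 0))))

suc-double≡ : ∀ k → suc (double k) ≡ 2 * k + 1
suc-double≡ k = trans (cong suc (double≡2* k)) (+-comm 1 (2 * k))

double-suc≡ : ∀ k → double (suc k) ≡ 2 * k + 2
double-suc≡ k = trans (cong (suc ∘ suc) (double≡2* k)) (+-comm 2 (2 * k))

⌈double/2⌉ : ∀ j → ⌈ double j /2⌉ ≡ j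
⌈double/2⌉ zero = refl
⌈double/2⌉ (suc j) = cong suc (⌈double/2⌉ j)

⌈suc-double/2⌉ : ∀ j → ⌈ suc (double j) /2⌉ ≡ suc j
⌈suc-double/2⌉ zero = refl
⌈suc-double/2⌉ (suc j) = cong suc (⌈suc-double/2⌉ j)

double-injective : ∀ {m n} → double m ≡ double n → m ≡ n
double-injective {zero} {zero} _ = refl
double-injective {suc m} {suc n} e = cong suc (double-injective (suc-injective (suc-injective e)))

double≢suc-double : ∀ m n → double m ≢ suc (double n)
double≢suc-double m n e = 0ℙ≢1ℙ (trans (sym (parity-double m)) (trans (cong parity e) (parity-suc-double n)))

-- Unique lists and a pigeonhole bound

Within : ℕ → ℕ → ℕ → Set
Within lo hi x = lo ≤ x × x < hi

allPairs-++⁻ : ∀ {A : Set} {R : A → A → Set} xs {ys} → AllPairs R (xs ++ ys) →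
               AllPairs R xs × AllPairs R ys × All (λ x → All (R x) ys) xs
allPairs-++⁻ [] p = [] , p , []
allPairs-++⁻ (x ∷ xs) (px ∷ p) with allPairs-++⁻ xs p | All.++⁻ xs px
... | pxs , pys , cross | pxl , pxr = pxl ∷ pxs , pys , pxr ∷ cross

unique-remove : ∀ {A : Set} (xs : List A) {x ys} → Unique (xs ++ x ∷ ys) → Unique (xs ++ ys) × All (x ≢_) (xs ++ ys)
unique-remove xs u with allPairs-++⁻ xs u
... | uxs , x∉ys ∷ uys , cross =
  AllPairs.++⁺ uxs uys (All.map All.tail cross) ,
  All.++⁺ (All.map (≢-sym ∘ All.head) cross) x∉ys

narrow : ∀ {lo h xs} → All (Within lo (suc h)) xs → All (h ≢_) xs → All (Within lo h) xs
narrow [] [] = []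
narrow ((lo≤x , x<sh) ∷ w) (h≢x ∷ ne) = (lo≤x , ≤∧≢⇒< (≤-pred x<sh) (≢-sym h≢x)) ∷ narrow w ne

unique-within-length : ∀ {lo} hi {xs} → lo ≤ hi → Unique xs → All (Within lo hi) xs → length xs + lo ≤ hi
unique-within-length zero {[]} lo≤0 _ _ = lo≤0
unique-within-length zero {x ∷ xs} _ _ ((_ , ()) ∷ _)
unique-within-length (suc h) {xs} lo≤hi u w with h ∈? xs
... | yes h∈xs with ∈-∃++ h∈xs
...   | α , β , refl = begin
  length (α ++ h ∷ β) + _    ≡⟨ cong (_+ _) (length-++-sucʳ α h β) ⟩
  suc (length (α ++ β) + _)  ≤⟨ s≤s (unique-within-length h lo≤h u′ (narrow (All.++⁺ wα wβ) h∉αβ)) ⟩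
  suc h                      ∎
  where
  open ≤-Reasoning
  u′ = proj₁ (unique-remove α u)
  h∉αβ = proj₂ (unique-remove α u)
  wα = proj₁ (All.++⁻ α w)
  wβ = All.tail (proj₂ (All.++⁻ α w))
  lo≤h = proj₁ (All.head (proj₂ (All.++⁻ α w)))
unique-within-length (suc h) {[]} lo≤hi _ _ | no _ = lo≤hi
unique-within-length (suc h) {x ∷ xs} _ u w | no h∉xs with narrow w (All.¬Any⇒All¬ (x ∷ xs) h∉xs)
... | w′@((lo≤x , x<h) ∷ _) = m≤n⇒m≤1+n (unique-within-length h (≤-trans lo≤x (<⇒≤ x<h)) u w′)

-- Permutations are handled as lists of their values 1, …, n rather than as vectors over Fin n.
-- Step p x y says that y may follow an entry x of parity p.
Step : Parity → ℕ → ℕ → Set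
Step 0ℙ x y = y < x
Step 1ℙ x y = x < y

IsDumontList : List ℕ → Set
IsDumontList [] = ⊤
IsDumontList (x ∷ []) = parity x ≡ 1ℙ
IsDumontList (x ∷ y ∷ xs) = Step (parity x) x y × IsDumontList (y ∷ xs)

step-even : ∀ {x y} → parity x ≡ 0ℙ → Step (parity x) x y → y < x
step-even {x} p s rewrite p = s

step-odd : ∀ {x y} → parity x ≡ 1ℙ → Step (parity x) x y → x < y
step-odd {x} p s rewrite p = s

step-≤⇒odd : ∀ {x y} → x ≤ y → Step (parity x) x y → parity x ≡ 1ℙ
step-≤⇒odd {x} x≤y s with parity x
... | 0ℙ = ⊥-elim (<⇒≱ s x≤y)
... | 1ℙ = refl

step->⇒even : ∀ {x y} → y < x → Step (parity x) x y → parity x ≡ 0ℙ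
step->⇒even {x} y<x s with parity x
... | 0ℙ = refl
... | 1ℙ = ⊥-elim (<-asym y<x s)

step-even⁺ : ∀ {x y} → parity x ≡ 0ℙ → y < x → Step (parity x) x y
step-even⁺ p y<x rewrite p = y<x

step-odd⁺ : ∀ {x y} → parity x ≡ 1ℙ → x < y → Step (parity x) x y
step-odd⁺ p x<y rewrite p = x<y

step-+ : ∀ p b {x y} → Step p x y → Step p (x + b) (y + b)
step-+ 0ℙ b s = +-monoˡ-< b s
step-+ 1ℙ b s = +-monoˡ-< b s

step-+⁻ : ∀ p b {x y} → Step p (x + b) (y + b) → Step p x y
step-+⁻ 0ℙ b s = +-cancelʳ-< b _ _ s
step-+⁻ 1ℙ b s = +-cancelʳ-< b _ _ s

dumont-tail : ∀ x xs → IsDumontList (x ∷ xs) → IsDumontList xs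
dumont-tail x [] _ = tt
dumont-tail x (y ∷ xs) (_ , d) = d

dumont-++⁻ʳ : ∀ xs {ys} → IsDumontList (xs ++ ys) → IsDumontList ys
dumont-++⁻ʳ [] d = d
dumont-++⁻ʳ (x ∷ xs) d = dumont-++⁻ʳ xs (dumont-tail x (xs ++ _) d)

dumont-step : ∀ xs {x y ys} → IsDumontList (xs ++ x ∷ y ∷ ys) → Step (parity x) x y
dumont-step xs d = proj₁ (dumont-++⁻ʳ xs d)

dumont-++⁻ˡ : ∀ xs {y ys} → IsDumontList (xs ++ y ∷ ys) → All (_< y) xs → IsDumontList xs
dumont-++⁻ˡ [] _ _ = tt
dumont-++⁻ˡ (x ∷ []) (s , _) (x<y ∷ []) = step-≤⇒odd (<⇒≤ x<y) s
dumont-++⁻ˡ (x ∷ x′ ∷ xs) (s , d) (_ ∷ lt) = s , dumont-++⁻ˡ (x′ ∷ xs) d lt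

dumont-++⁺ : ∀ xs {y ys} → IsDumontList xs → All (_< y) xs → IsDumontList (y ∷ ys) → IsDumontList (xs ++ y ∷ ys)
dumont-++⁺ [] _ _ d = d
dumont-++⁺ (x ∷ []) x-odd (x<y ∷ []) d = step-odd⁺ x-odd x<y , d
dumont-++⁺ (x ∷ x′ ∷ xs) (s , d′) (_ ∷ lt) d = s , dumont-++⁺ (x′ ∷ xs) d′ lt d

module _ {b} (b-even : parity b ≡ 0ℙ) where

  parity-+b : ∀ x → parity (x + b) ≡ parity x
  parity-+b x = parity-+-even x b-even

  dumont-map-+ : ∀ xs → IsDumontList xs → IsDumontList (map (_+ b) xs)
  dumont-map-+ [] _ = tt
  dumont-map-+ (x ∷ []) x-odd = trans (parity-+b x) x-odd
  dumont-map-+ (x ∷ y ∷ xs) (s , d) =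
    subst (λ p → Step p (x + b) (y + b)) (sym (parity-+b x)) (step-+ (parity x) b s) ,
    dumont-map-+ (y ∷ xs) d

  dumont-map-+⁻ : ∀ xs → IsDumontList (map (_+ b) xs) → IsDumontList xs
  dumont-map-+⁻ [] _ = tt
  dumont-map-+⁻ (x ∷ []) x-odd = trans (sym (parity-+b x)) x-odd
  dumont-map-+⁻ (x ∷ y ∷ xs) (s , d) =
    step-+⁻ (parity x) b (subst (λ p → Step p (x + b) (y + b)) (parity-+b x) s) ,
    dumont-map-+⁻ (y ∷ xs) d

-- 132-avoiding lists

No132After : ℕ → List ℕ → Set
No132After a = AllPairs (λ y z → ¬ (a < z × z < y))

Avoids132List : List ℕ → Set
Avoids132List [] = ⊤
Avoids132List (x ∷ xs) = No132After x xs × Avoids132List xs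

below⇒¬132 : ∀ {a y xs} → All (_≤ a) xs → All (λ z → ¬ (a < z × z < y)) xs
below⇒¬132 = All.map (λ z≤a (a<z , _) → <⇒≱ a<z z≤a)

no132-below : ∀ {a xs} → All (_≤ a) xs → No132After a xs
no132-below [] = []
no132-below (_ ∷ le) = below⇒¬132 le ∷ no132-below le

avoids-++⁻ˡ : ∀ xs {ys} → Avoids132List (xs ++ ys) → Avoids132List xs
avoids-++⁻ˡ [] _ = tt
avoids-++⁻ˡ (x ∷ xs) (n , a) = proj₁ (allPairs-++⁻ xs n) , avoids-++⁻ˡ xs a

avoids-++⁻ʳ : ∀ xs {ys} → Avoids132List (xs ++ ys) → Avoids132List ys
avoids-++⁻ʳ [] a = a
avoids-++⁻ʳ (x ∷ xs) (_ , a) = avoids-++⁻ʳ xs a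

avoids-above-max : ∀ α {N β} → Avoids132List (α ++ N ∷ β) → All (_< N) β → All (λ a → All (_≤ a) β) α
avoids-above-max [] _ _ = []
avoids-above-max (a ∷ α) (n , av) β<N with allPairs-++⁻ α n
... | _ , no-aNβ ∷ _ , _ =
  All.zipWith (λ (¬a<z<N , z<N) → ≮⇒≥ (λ a<z → ¬a<z<N (a<z , z<N))) (no-aNβ , β<N) ∷ avoids-above-max α av β<N

avoids-++⁺ : ∀ α {N β} → Avoids132List α → Avoids132List β → All (λ a → All (_≤ a) β) α →
             All (_< N) α → All (_< N) β → Avoids132List (α ++ N ∷ β)
avoids-++⁺ [] _ avβ _ _ β<N = no132-below (All.map <⇒≤ β<N) , avβ
avoids-++⁺ (a ∷ α) (n , avα) avβ (β≤a ∷ β≤α) (_ ∷ α<N) β<N =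
  AllPairs.++⁺ n (below⇒¬132 β≤a ∷ no132-below β≤a) (All.map (λ y<N → (λ (_ , N<y) → <-asym y<N N<y) ∷ below⇒¬132 β≤a) α<N) ,
  avoids-++⁺ α avα avβ β≤α α<N β<N

module _ (f : ℕ → ℕ) where

  avoids-map⁺ : (∀ {x y} → f x < f y → x < y) → ∀ xs → Avoids132List xs → Avoids132List (map f xs)
  avoids-map⁺ reflect [] _ = tt
  avoids-map⁺ reflect (x ∷ xs) (n , av) =
    AllPairs.map⁺ (AllPairs.map (λ ¬p (p , q) → ¬p (reflect p , reflect q)) n) , avoids-map⁺ reflect xs av

  avoids-map⁻ : (∀ {x y} → x < y → f x < f y) → ∀ xs → Avoids132List (map f xs) → Avoids132List xs
  avoids-map⁻ mono [] _ = tt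
  avoids-map⁻ mono (x ∷ xs) (n , av) =
    AllPairs.map (λ ¬p (p , q) → ¬p (mono p , mono q)) (AllPairs.map⁻ n) , avoids-map⁻ mono xs av

-- Splitting at the maximum

-- The parity the maximum needs in order to be followed by β: odd at the end, even otherwise.
maxParity : List ℕ → Parity
maxParity [] = 1ℙ
maxParity (_ ∷ _) = 0ℙ

dumont-∷-max⁻ : ∀ {N} β → All (_< N) β → IsDumontList (N ∷ β) → parity N ≡ maxParity β
dumont-∷-max⁻ [] _ N-odd = N-odd
dumont-∷-max⁻ (c ∷ β) (c<N ∷ _) (s , _) = step->⇒even c<N s

dumont-∷-max⁺ : ∀ {N} β → All (_< N) β → parity N ≡ maxParity β → IsDumontList β → IsDumontList (N ∷ β)
dumont-∷-max⁺ [] _ N-odd _ = N-odd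
dumont-∷-max⁺ (c ∷ β) (c<N ∷ _) N-even d = step-even⁺ N-even c<N , d

-- The inverse of splitting a 132-avoiding permutation α n β at its maximum n: α is shifted above β.
glue : List ℕ → List ℕ → List ℕ
glue α β = map (_+ length β) α ++ suc (length α + length β) ∷ β

map-+-∸ : ∀ b xs → All (b ≤_) xs → map (_+ b) (map (_∸ b) xs) ≡ xs
map-+-∸ b [] _ = refl
map-+-∸ b (x ∷ xs) (b≤x ∷ b≤xs) = cong₂ _∷_ (m∸n+n≡m b≤x) (map-+-∸ b xs b≤xs)

length-glue : ∀ α β → length (glue α β) ≡ suc (length α + length β)
length-glue α β = trans (length-++-sucʳ (map (_+ length β) α) _ β)
                        (cong suc (trans (length-++ (map (_+ length β) α)) (cong (_+ length β) (length-map _ α))))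

++-∷-cancel-max : ∀ {N} p {q} p′ {q′} → All (_< N) p → All (_< N) p′ → p ++ N ∷ q ≡ p′ ++ N ∷ q′ → p ≡ p′ × q ≡ q′
++-∷-cancel-max [] [] _ _ eq = refl , ∷-injectiveʳ eq
++-∷-cancel-max [] (x′ ∷ p′) _ (x′<N ∷ _) eq = ⊥-elim (<-irrefl (sym (∷-injectiveˡ eq)) x′<N)
++-∷-cancel-max (x ∷ p) [] (x<N ∷ _) _ eq = ⊥-elim (<-irrefl (∷-injectiveˡ eq) x<N)
++-∷-cancel-max (x ∷ p) (x′ ∷ p′) (_ ∷ p<N) (_ ∷ p′<N) eq with ++-∷-cancel-max p p′ p<N p′<N (∷-injectiveʳ eq)
... | p≡p′ , q≡q′ = cong₂ _∷_ (∷-injectiveˡ eq) p≡p′ , q≡q′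

record IsDumont132 (n : ℕ) (xs : List ℕ) : Set where
  field
    length≡ : length xs ≡ n
    within  : All (Within 1 (suc n)) xs
    unique  : Unique xs
    dumont  : IsDumontList xs
    avoids  : Avoids132List xs
open IsDumont132

bounded : ∀ {n xs} → IsDumont132 n xs → All (_≤ n) xs
bounded v = All.map (≤-pred ∘ proj₂) (within v)

max∈ : ∀ {n xs} → .(length xs ≡ suc n) → .(All (Within 1 (suc (suc n))) xs) → .(Unique xs) → suc n ∈ xs
max∈ {n} {xs} l w u with suc n ∈? xs
... | yes N∈xs = N∈xs
... | no N∉xs = Irr.⊥-elim (m+1+n≰m (suc n) (subst (λ l → l + 1 ≤ suc n) l
      (unique-within-length (suc n) (s≤s z≤n) u (narrow w (All.¬Any⇒All¬ xs N∉xs)))))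

module AroundMax {n} α β (v : IsDumont132 (suc n) (α ++ suc n ∷ β)) where

  N = suc n
  b = length β

  lengths : length α + b ≡ n
  lengths = trans (sym (length-++ α)) (suc-injective (trans (sym (length-++-sucʳ α N β)) (length≡ v)))

  private
    uniqueness = allPairs-++⁻ α (unique v)
    withinα = proj₁ (All.++⁻ α (within v))
    withinβ = All.tail (proj₂ (All.++⁻ α (within v)))
    α≢Nβ : All (λ a → All (a ≢_) (N ∷ β)) α
    α≢Nβ = proj₂ (proj₂ uniqueness)

  uniqueα : Unique α
  uniqueα = proj₁ uniqueness

  uniqueβ : Unique β
  uniqueβ = AllPairs.tail (proj₁ (proj₂ uniqueness))

  α<N : All (_< N) α
  α<N = All.zipWith (λ ((_ , a≤N) , a≢N) → ≤∧≢⇒< (≤-pred a≤N) (All.head a≢N)) (withinα , α≢Nβ)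

  β<N : All (_< N) β
  β<N = All.zipWith (λ ((_ , c≤N) , N≢c) → ≤∧≢⇒< (≤-pred c≤N) (≢-sym N≢c))
                    (withinβ , AllPairs.head (proj₁ (proj₂ uniqueness)))

  β<α : All (λ a → All (_< a) β) α
  β<α = All.zipWith (λ (β≤a , a≢β) → All.zipWith (λ (c≤a , a≢c) → ≤∧≢⇒< c≤a (≢-sym a≢c)) (β≤a , All.tail a≢β))
                    (avoids-above-max α (avoids v) β<N , α≢Nβ)

  β≤b : All (_≤ b) β
  β≤b = All.zipWith bound (All.All-swap β<α , β<N)
    where
    bound : ∀ {c} → All (c <_) α × c < N → c ≤ b
    bound {c} (c<α , c<N) = +-cancelˡ-≤ (length α) c b (≤-pred (begin
      suc (length α + c)  ≡⟨ sym (+-suc (length α) c) ⟩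
      length α + suc c    ≤⟨ unique-within-length N c<N uniqueα (All.zipWith (λ (c<a , a<N) → c<a , a<N) (c<α , α<N)) ⟩
      N                   ≡⟨ cong suc (sym lengths) ⟩
      suc (length α + b)  ∎))
      where open ≤-Reasoning

  b<α : All (b <_) α
  b<α = All.zipWith bound (β<α , withinα)
    where
    bound : ∀ {a} → All (_< a) β × Within 1 (suc N) a → b < a
    bound {a} (β<a , 1≤a , _) = subst (_≤ a) (+-comm b 1)
      (unique-within-length a 1≤a uniqueβ (All.zipWith (λ ((1≤c , _) , c<a) → 1≤c , c<a) (withinβ , β<a)))

  dumontα : IsDumontList α
  dumontα = dumont-++⁻ˡ α (dumont v) α<N

  dumontNβ : IsDumontList (N ∷ β)
  dumontNβ = dumont-++⁻ʳ α (dumont v)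

  top-parity : parity N ≡ maxParity β
  top-parity = dumont-∷-max⁻ β β<N dumontNβ

  -- If b were odd and α nonempty, then b + 1 would be an entry of α (by pigeonhole), even, and
  -- followed by a larger entry: everything after it in α exceeds b, and so does n.
  private
    suc-b∈α : 0 < length α → suc b ∈ α
    suc-b∈α α-nonempty with suc b ∈? α
    ... | yes sb∈α = sb∈α
    ... | no sb∉α = ⊥-elim (m+1+n≰m (suc (length α + b)) (begin
      suc (length α + b) + 1    ≡⟨ +-comm _ 1 ⟩
      suc (suc (length α + b))  ≡⟨ sym (cong suc (+-suc (length α) b)) ⟩
      suc (length α + suc b)    ≡⟨ sym (+-suc (length α) (suc b)) ⟩
      length α + suc (suc b)    ≤⟨ unique-within-length N sb<N uniqueα above ⟩
      N                         ≡⟨ cong suc (sym lengths) ⟩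
      suc (length α + b)        ∎))
      where
      open ≤-Reasoning
      above : All (Within (suc (suc b)) N) α
      above = All.zipWith (λ ((b<a , a<N) , sb≢a) → ≤∧≢⇒< b<a sb≢a , a<N) (All.zip (b<α , α<N) , All.¬Any⇒All¬ α sb∉α)
      sb<N : suc (suc b) ≤ N
      sb<N = s≤s (subst (suc b ≤_) lengths (+-monoˡ-≤ b α-nonempty))

    split-at : ∀ p q → α ≡ p ++ suc b ∷ q → α ++ N ∷ β ≡ p ++ suc b ∷ (q ++ N ∷ β)
    split-at p q α≡ = trans (cong (_++ N ∷ β) α≡) (++-assoc p (suc b ∷ q) (N ∷ β))

    gap-odd : ∀ p q → α ≡ p ++ suc b ∷ q → parity (suc b) ≡ 1ℙ
    gap-odd p [] α≡ = step-≤⇒odd (s≤s (subst (b ≤_) lengths (m≤n+m b (length α))))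
      (dumont-step p (subst IsDumontList (split-at p [] α≡) (dumont v)))
    gap-odd p (z ∷ q) α≡ = step-≤⇒odd (All.head (All.tail (proj₂ (All.++⁻ p (subst (All (b <_)) α≡ b<α)))))
      (dumont-step p (subst IsDumontList (split-at p (z ∷ q) α≡) (dumont v)))

    shift-even′ : ∀ α₀ → α ≡ α₀ → α ≡ [] ⊎ parity b ≡ 0ℙ
    shift-even′ [] α≡[] = inj₁ α≡[]
    shift-even′ (x ∷ α₀) α≡ with ∈-∃++ (suc-b∈α (subst (λ l → 0 < length l) (sym α≡) (s≤s z≤n)))
    ... | p , q , α≡p++sb∷q = inj₂ (trans (sym (ℙ.suc-homo-⁻¹ b)) (cong ℙ._⁻¹ (gap-odd p q α≡p++sb∷q)))

  shift-even : α ≡ [] ⊎ parity b ≡ 0ℙ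
  shift-even = shift-even′ α refl

  left : List ℕ
  left = map (_∸ b) α

  shift : map (_+ b) left ≡ α
  shift = map-+-∸ b α (All.map <⇒≤ b<α)

  split : α ++ N ∷ β ≡ glue left β
  split = sym (cong₂ (λ l m → l ++ suc m ∷ β) shift (trans (cong (_+ b) (length-map (_∸ b) α)) lengths))

  left-valid : IsDumont132 (length left) left
  left-valid = record
    { length≡ = refl
    ; within = subst (λ l → All (Within 1 (suc l)) left) (sym (length-map (_∸ b) α))
                 (All.map⁺ (All.zipWith (λ (b<a , a<N) → m<n⇒0<n∸m b<a , s≤s (below a<N)) (b<α , α<N)))
    ; unique = Unique.map⁻ (subst Unique (sym shift) uniqueα)
    ; dumont = dumont-left shift-even
    ; avoids = avoids-map⁻ (_+ b) (+-monoˡ-< b) left (subst Avoids132List (sym shift) (avoids-++⁻ˡ α (avoids v)))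
    }
    where
    below : ∀ {a} → a < N → a ∸ b ≤ length α
    below {a} a<N = subst (a ∸ b ≤_) (m+n∸n≡m (length α) b)
                      (∸-monoˡ-≤ b (subst (a ≤_) (sym lengths) (≤-pred a<N)))
    dumont-left : α ≡ [] ⊎ parity b ≡ 0ℙ → IsDumontList left
    dumont-left (inj₁ α≡[]) = subst (IsDumontList ∘ map (_∸ b)) (sym α≡[]) tt
    dumont-left (inj₂ b-even) = dumont-map-+⁻ b-even left (subst IsDumontList (sym shift) dumontα)

  right-valid : IsDumont132 b β
  right-valid = record
    { length≡ = refl
    ; within = All.zipWith (λ ((1≤c , _) , c≤b) → 1≤c , s≤s c≤b) (withinβ , β≤b)
    ; unique = uniqueβ
    ; dumont = dumont-tail N β dumontNβ
    ; avoids = proj₂ (avoids-++⁻ʳ α (avoids v))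
    }

record Decomposition (n : ℕ) (xs : List ℕ) : Set where
  field
    left right   : List ℕ
    .lengths     : length left + length right ≡ n
    .split       : xs ≡ glue left right
    .left-valid  : IsDumont132 (length left) left
    .right-valid : IsDumont132 (length right) right
    .top-parity  : parity (suc n) ≡ maxParity right
    .shift-even  : left ≡ [] ⊎ parity (length right) ≡ 0ℙ

decompose : ∀ {n xs} → .(IsDumont132 (suc n) xs) → Decomposition n xs
decompose {n} v with ∈-∃++ (max∈ (length≡ v) (within v) (unique v))
... | α , β , refl = record
  { left = map (_∸ length β) α
  ; right = β
  ; lengths = trans (cong (_+ length β) (length-map (_∸ length β) α)) (M.lengths v)
  ; split = M.split v
  ; left-valid = M.left-valid v
  ; right-valid = M.right-valid v
  ; top-parity = M.top-parity v
  ; shift-even = Data.Sum.map₁ (cong (map (_∸ length β))) (M.shift-even v)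
  }
  where module M = AroundMax α β

module _ (α β : List ℕ) where

  private
    a = length α
    b = length β
    N = suc (a + b)
    α⁺ = map (_+ b) α

  shifted<top : All (_≤ a) α → All (_< N) α⁺
  shifted<top α≤a = All.map⁺ (All.map (λ x≤a → s≤s (+-monoˡ-≤ b x≤a)) α≤a)

  glue-valid : IsDumont132 a α → IsDumont132 b β → parity N ≡ maxParity β → α ≡ [] ⊎ parity b ≡ 0ℙ →
               IsDumont132 N (glue α β)
  glue-valid vα vβ top-parity shift-even = record
    { length≡ = length-glue α β
    ; within = All.++⁺ (All.zipWith (λ (b<x , x<N) → ≤-trans (s≤s z≤n) b<x , m<n⇒m<1+n x<N) (b<α⁺ , α⁺<N))
                       ((s≤s z≤n , ≤-refl) ∷ All.map (λ (1≤c , c≤b) → 1≤c , m<n⇒m<1+n (c<N c≤b)) (All.zip (All.map proj₁ (within vβ) , β≤b)))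
    ; unique = AllPairs.++⁺ (Unique.map⁺ (+-cancelʳ-≡ b _ _) (unique vα))
                            (All.map (λ c≤b → ≢-sym (<⇒≢ (c<N c≤b))) β≤b ∷ unique vβ)
                            (All.zipWith (λ (x<N , b<x) → <⇒≢ x<N ∷ All.map (λ c≤b → ≢-sym (<⇒≢ (≤-<-trans c≤b b<x))) β≤b)
                                         (α⁺<N , b<α⁺))
    ; dumont = dumont-++⁺ α⁺ dumont⁺ α⁺<N (dumont-∷-max⁺ β (All.map c<N β≤b) top-parity (dumont vβ))
    ; avoids = avoids-++⁺ α⁺ (avoids-map⁺ (_+ b) (+-cancelʳ-< b _ _) α (avoids vα)) (avoids vβ)
                          (All.map (λ b<x → All.map (λ c≤b → ≤-trans c≤b (<⇒≤ b<x)) β≤b) b<α⁺)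
                          α⁺<N (All.map c<N β≤b)
    }
    where
    α⁺<N = shifted<top (bounded vα)
    b<α⁺ : All (b <_) α⁺
    b<α⁺ = All.map⁺ (All.map (λ (1≤x , _) → m<n+m b 1≤x) (within vα))
    β≤b = bounded vβ
    c<N : ∀ {c} → c ≤ b → c < N
    c<N c≤b = s≤s (≤-trans c≤b (m≤n+m b a))
    dumont⁺ : IsDumontList α⁺
    dumont⁺ = Data.Sum.[ (λ α≡[] → subst (IsDumontList ∘ map (_+ b)) (sym α≡[]) tt)
                       , (λ b-even → dumont-map-+ b-even α (dumont vα)) ] shift-even

glue-injective : ∀ α β α′ β′ → All (_≤ length α) α → All (_≤ length α′) α′ → glue α β ≡ glue α′ β′ → α ≡ α′ × β ≡ β′
glue-injective α β α′ β′ α≤ α′≤ eq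
  with ++-∷-cancel-max (map (_+ length β) α) (map (_+ length β′) α′) (shifted<top α β α≤)
                       (subst (λ N → All (_< N) (map (_+ length β′) α′)) (sym N≡) (shifted<top α′ β′ α′≤))
                       (trans eq (cong (λ N → map (_+ length β′) α′ ++ N ∷ β′) (sym N≡)))
  where
  N≡ : suc (length α + length β) ≡ suc (length α′ + length β′)
  N≡ = trans (sym (length-glue α β)) (trans (cong length eq) (length-glue α′ β′))
... | α⁺≡α′⁺ , refl = map-injective (λ {x} {y} → +-cancelʳ-≡ (length β) x y) α⁺≡α′⁺ , refl

-- Rises of Dumont lists

oddness : Parity → ℕ
oddness 0ℙ = 0
oddness 1ℙ = 1

oddCount : List ℕ → ℕ
oddCount xs = sum (map (oddness ∘ parity) xs)

oddCount-++ : ∀ xs ys → oddCount (xs ++ ys) ≡ oddCount xs + oddCount ys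
oddCount-++ xs ys = trans (cong sum (map-++ (oddness ∘ parity) xs ys)) (sum-++ (map (oddness ∘ parity) xs) _)

⌈1+n/2⌉ : ∀ n → ⌈ suc n /2⌉ ≡ oddness (parity (suc n)) + ⌈ n /2⌉
⌈1+n/2⌉ zero = refl
⌈1+n/2⌉ (suc zero) = refl
⌈1+n/2⌉ (suc (suc n)) = trans (cong suc (⌈1+n/2⌉ n)) (sym (+-suc _ ⌈ n /2⌉))

oddCount-permutation : ∀ n xs → length xs ≡ n → All (Within 1 (suc n)) xs → Unique xs → oddCount xs ≡ ⌈ n /2⌉
oddCount-permutation zero [] _ _ _ = refl
oddCount-permutation (suc n) xs l w u with ∈-∃++ (max∈ l w u)
... | α , β , refl = begin
  oddCount (α ++ N ∷ β)                           ≡⟨ oddCount-++ α (N ∷ β) ⟩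
  oddCount α + (oddness (parity N) + oddCount β)  ≡⟨ +-comm-middle (oddCount α) (oddness (parity N)) (oddCount β) ⟩
  oddness (parity N) + (oddCount α + oddCount β)  ≡⟨ cong (oddness (parity N) +_) (sym (oddCount-++ α β)) ⟩
  oddness (parity N) + oddCount (α ++ β)          ≡⟨ cong (oddness (parity N) +_) (oddCount-permutation n (α ++ β) l′ w′ u′) ⟩
  oddness (parity N) + ⌈ n /2⌉                    ≡⟨ sym (⌈1+n/2⌉ n) ⟩
  ⌈ N /2⌉                                         ∎
  where
  open ≡-Reasoning
  N = suc n
  l′ : length (α ++ β) ≡ n
  l′ = suc-injective (trans (sym (length-++-sucʳ α N β)) l)
  u′ = proj₁ (unique-remove α u)
  w′ : All (Within 1 (suc n)) (α ++ β)
  w′ = narrow (All.++⁺ (proj₁ (All.++⁻ α w)) (All.tail (proj₂ (All.++⁻ α w)))) (proj₂ (unique-remove α u))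
  +-comm-middle : ∀ a b c → a + (b + c) ≡ b + (a + c)
  +-comm-middle = solve-∀

<ᵇ-true : ∀ {x y} → x < y → (x <ᵇ y) ≡ true
<ᵇ-true x<y = Equivalence.to T-≡ (<⇒<ᵇ x<y)

<ᵇ-false : ∀ {x y} → y < x → (x <ᵇ y) ≡ false
<ᵇ-false {x} {y} y<x with x <ᵇ y in eq
... | false = refl
... | true = ⊥-elim (<-asym y<x (<ᵇ⇒< x y (Equivalence.from T-≡ eq)))

dumont-rises : ∀ x xs → IsDumontList (x ∷ xs) → suc (risesL (x ∷ xs)) ≡ oddCount (x ∷ xs)
dumont-rises x [] odd rewrite odd = refl
dumont-rises x (y ∷ xs) (s , d) with parity-cases x
... | inj₁ even = begin
  suc ((if x <ᵇ y then 1 else 0) + risesL (y ∷ xs))  ≡⟨ cong (λ b → suc ((if b then 1 else 0) + risesL (y ∷ xs))) (<ᵇ-false (step-even even s)) ⟩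
  suc (risesL (y ∷ xs))                              ≡⟨ dumont-rises y xs d ⟩
  oddCount (y ∷ xs)                                  ≡⟨ cong (λ p → oddness p + oddCount (y ∷ xs)) (sym even) ⟩
  oddCount (x ∷ y ∷ xs)                              ∎
  where open ≡-Reasoning
... | inj₂ odd = begin
  suc ((if x <ᵇ y then 1 else 0) + risesL (y ∷ xs))  ≡⟨ cong (λ b → suc ((if b then 1 else 0) + risesL (y ∷ xs))) (<ᵇ-true (step-odd odd s)) ⟩
  suc (suc (risesL (y ∷ xs)))                        ≡⟨ cong suc (dumont-rises y xs d) ⟩
  suc (oddCount (y ∷ xs))                            ≡⟨ cong (λ p → oddness p + oddCount (y ∷ xs)) (sym odd) ⟩
  oddCount (x ∷ y ∷ xs)                              ∎
  where open ≡-Reasoning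

rises-Dumont132 : ∀ n xs → IsDumont132 n xs → risesL xs ≡ pred ⌈ n /2⌉
rises-Dumont132 n [] v = cong (pred ∘ ⌈_/2⌉) (length≡ v)
rises-Dumont132 n (x ∷ xs) v =
  cong pred (trans (dumont-rises x xs (dumont v)) (oddCount-permutation n (x ∷ xs) (length≡ v) (within v) (unique v)))

-- The Catalan recurrence for 132-avoiding Dumont permutations

empty-valid : IsDumont132 0 []
empty-valid = record { length≡ = refl ; within = [] ; unique = [] ; dumont = tt ; avoids = tt }

reindex : ∀ {n xs} → IsDumont132 n xs → IsDumont132 (length xs) xs
reindex {xs = xs} v = subst (λ n → IsDumont132 n xs) (sym (length≡ v)) v

maxParity-++-∷ : ∀ xs {y ys} → maxParity (xs ++ y ∷ ys) ≡ 0ℙ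
maxParity-++-∷ [] = refl
maxParity-++-∷ (_ ∷ _) = refl

record Dumont132 (n : ℕ) : Set where
  constructor d132
  field
    list   : List ℕ
    .valid : IsDumont132 n list
open Dumont132

Dumont132-≡ : ∀ {n} {p q : Dumont132 n} → list p ≡ list q → p ≡ q
Dumont132-≡ refl = refl

-- Validity proofs are irrelevant, so equations extracted from them are recomputed by decision.
recompute-≡ : {xs ys : List ℕ} → .(xs ≡ ys) → xs ≡ ys
recompute-≡ {xs} {ys} = recompute (≡-dec _≟_ xs ys)

recompute-≡ℕ : {m n : ℕ} → .(m ≡ n) → m ≡ n
recompute-≡ℕ {m} {n} = recompute (m ≟ n)

length-list : ∀ {n} (x : Dumont132 n) → length (list x) ≡ n
length-list (d132 _ v) = recompute-≡ℕ (length≡ v)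

Dumont132-zero-unique : (x y : Dumont132 0) → x ≡ y
Dumont132-zero-unique x y = Dumont132-≡ (trans (length-0 (list x) (length-list x)) (sym (length-0 (list y) (length-list y))))
  where
  length-0 : ∀ xs → length xs ≡ 0 → xs ≡ []
  length-0 [] _ = refl

glue132 : ∀ {a b n} (p : Dumont132 a) (q : Dumont132 b) → .(a + b ≡ n) →
          .(parity (suc n) ≡ maxParity (list q)) → .(list p ≡ [] ⊎ parity b ≡ 0ℙ) → Dumont132 (suc n)
glue132 {a} {b} {n} (d132 α vα) (d132 β vβ) a+b≡n top shift = d132 (glue α β)
  (subst (λ n → IsDumont132 (suc n) (glue α β)) (trans (sym lengths) a+b≡n)
    (glue-valid α β (reindex vα) (reindex vβ)
      (subst (λ n → parity (suc n) ≡ maxParity β) (trans (sym a+b≡n) lengths) top)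
      (Data.Sum.map₂ (trans (cong parity (length≡ vβ))) shift)))
  where
  lengths : a + b ≡ length α + length β
  lengths = recompute-≡ℕ (cong₂ _+_ (sym (length≡ vα)) (sym (length≡ vβ)))

glue132-injective : ∀ {a b a′ b′} (p : Dumont132 a) (q : Dumont132 b) (p′ : Dumont132 a′) (q′ : Dumont132 b′) →
  glue (list p) (list q) ≡ glue (list p′) (list q′) → list p ≡ list p′ × list q ≡ list q′
glue132-injective (d132 α vα) (d132 β _) (d132 α′ vα′) (d132 β′ _) eq =
  recompute-≡ (proj₁ (injective vα vα′)) , recompute-≡ (proj₂ (injective vα vα′))
  where
  injective : IsDumont132 _ α → IsDumont132 _ α′ → α ≡ α′ × β ≡ β′
  injective vα vα′ = glue-injective α β α′ β′ (bounded (reindex vα)) (bounded (reindex vα′)) eq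

mk↔ : ∀ {A B : Set} (f : A → B) → (∀ {x y} → f x ≡ f y → x ≡ y) → (∀ y → ∃ λ x → f x ≡ y) → A ↔ B
mk↔ f injective surjective = ⤖⇒↔ (mk⤖ (injective , strictlySurjective⇒surjective surjective))

empty132 : Dumont132 0
empty132 = d132 [] empty-valid

append-max : ∀ m → Dumont132 (double m) → Dumont132 (suc (double m))
append-max m x = glue132 x empty132 (+-identityʳ (double m)) (parity-suc-double m) (inj₂ refl)

append-max-injective : ∀ m {x y} → append-max m x ≡ append-max m y → x ≡ y
append-max-injective m {x} {y} eq = Dumont132-≡ (proj₁ (glue132-injective x empty132 y empty132 (cong list eq)))

append-max-surjective : ∀ m (y : Dumont132 (suc (double m))) → ∃ λ x → append-max m x ≡ y
append-max-surjective m (d132 xs v) with decompose v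
... | record { left = α ; right = [] ; lengths = l ; split = s ; left-valid = lv } =
  d132 α (subst (λ n → IsDumont132 n α) (trans (sym (+-identityʳ _)) l) lv) , Dumont132-≡ (sym (recompute-≡ s))
... | record { right = _ ∷ _ ; top-parity = top } = Irr.⊥-elim (0ℙ≢1ℙ (trans (sym top) (parity-suc-double m)))

even↔odd : ∀ m → Dumont132 (double m) ↔ Dumont132 (suc (double m))
even↔odd m = mk↔ (append-max m) (append-max-injective m) (append-max-surjective m)

Convolution : (ℕ → Set) → (ℕ → Set) → ℕ → Set
Convolution S T m = Σ ℕ λ j → Σ ℕ λ k → j + k ≡ m × S j × T k

convolution-≡ : ∀ {S T : ℕ → Set} {m j k} {p p′ : j + k ≡ m} {s s′ : S j} {t t′ : T k} →
                s ≡ s′ → t ≡ t′ → _≡_ {A = Convolution S T m} (j , k , p , s , t) (j , k , p′ , s′ , t′)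
convolution-≡ {p = p} {p′} refl refl rewrite ≡-irrelevant p p′ = refl

Even132 : ℕ → Set
Even132 m = Dumont132 (double m)

odd+even≡ : ∀ j k → suc (double k) + double (suc j) ≡ suc (double (suc j + k))
odd+even≡ j k = cong suc (trans (sym (double-+ k (suc j))) (cong double (+-comm k (suc j))))

maxParity-nonempty : ∀ xs {n} → length xs ≡ suc n → maxParity xs ≡ 0ℙ
maxParity-nonempty (_ ∷ _) _ = refl

glue≢[] : ∀ α β → glue α β ≢ []
glue≢[] [] β ()
glue≢[] (_ ∷ _) β ()

root-glue : ∀ m → Convolution Even132 Even132 m → Even132 (suc m)
root-glue m (zero , _ , refl , _ , x) =
  glue132 empty132 (append-max m x) refl
    (trans (parity-double (suc m)) (sym (maxParity-++-∷ (map _ (list x))))) (inj₁ refl)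
root-glue m (suc j , k , p , y , x) =
  glue132 (append-max k x) y (trans (odd+even≡ j k) (cong (suc ∘ double) p))
    (trans (parity-double (suc m)) (sym (maxParity-nonempty (list y) (length-list y)))) (inj₂ (parity-double (suc j)))

root-glue-injective : ∀ m {c c′} → root-glue m c ≡ root-glue m c′ → c ≡ c′
root-glue-injective m {zero , _ , refl , z , x} {zero , _ , refl , z′ , x′} eq =
  convolution-≡ (Dumont132-zero-unique z z′)
    (append-max-injective m (Dumont132-≡ (proj₂ (glue132-injective empty132 (append-max m x) empty132 (append-max m x′) (cong list eq)))))
root-glue-injective m {zero , _ , refl , _ , x} {suc j′ , k′ , _ , y′ , x′} eq =
  ⊥-elim (glue≢[] _ _ (sym (proj₁ (glue132-injective empty132 (append-max m x) (append-max k′ x′) y′ (cong list eq)))))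
root-glue-injective m {suc j , k , _ , y , x} {zero , _ , refl , _ , x′} eq =
  ⊥-elim (glue≢[] _ _ (proj₁ (glue132-injective (append-max k x) y empty132 (append-max m x′) (cong list eq))))
root-glue-injective m {suc j , k , _ , y , x} {suc j′ , k′ , _ , y′ , x′} eq
  with glue132-injective (append-max k x) y (append-max k′ x′) y′ (cong list eq)
... | ex , ey with suc-injective (double-injective (same-length y y′ ey))
                 | double-injective (suc-injective (same-length (append-max k x) (append-max k′ x′) ex))
  where
  same-length : ∀ {a a′} (u : Dumont132 a) (u′ : Dumont132 a′) → list u ≡ list u′ → a ≡ a′
  same-length u u′ e = trans (sym (length-list u)) (trans (cong length e) (length-list u′))
...   | refl | refl = convolution-≡ (Dumont132-≡ ey) (append-max-injective k (Dumont132-≡ ex))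

root-glue-surjective : ∀ m (z : Even132 (suc m)) → ∃ λ c → root-glue m c ≡ z
root-glue-surjective m (d132 xs v) with decompose v
... | record { right = [] ; top-parity = top } = Irr.⊥-elim (0ℙ≢1ℙ (trans (sym (parity-double (suc m))) top))
... | record { left = [] ; right = β@(_ ∷ _) ; lengths = l ; split = s ; right-valid = vβ }
  with append-max-surjective m (d132 β (subst (λ n → IsDumont132 n β) l vβ))
...   | x , ex = (zero , m , refl , empty132 , x) , Dumont132-≡ (trans (cong (glue [] ∘ list) ex) (sym (recompute-≡ s)))
root-glue-surjective m (d132 xs v) | record { left = α@(_ ∷ _) ; right = β@(_ ∷ _) ; lengths = l ; split = s
                                             ; left-valid = vα ; right-valid = vβ ; shift-even = shift }
  with even-or-odd (length β) | even-or-odd (length α)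
... | inj₂ (j , eqβ) | _ = Irr.⊥-elim (β-even shift)
  where
  β-even : α ≡ [] ⊎ parity (length β) ≡ 0ℙ → ⊥
  β-even (inj₂ even) = 0ℙ≢1ℙ (trans (sym even) (trans (cong parity eqβ) (parity-suc-double j)))
... | inj₁ (suc j , eqβ) | inj₁ (k , eqα) =
  Irr.⊥-elim (double≢suc-double (k + suc j) m (trans (double-+ k (suc j)) (trans (cong₂ _+_ (sym eqα) (sym eqβ)) l)))
... | inj₁ (suc j , eqβ) | inj₂ (k , eqα)
  with append-max-surjective k (d132 α (subst (λ n → IsDumont132 n α) eqα vα))
...   | x , ex = (suc j , k , p , d132 β (subst (λ n → IsDumont132 n β) eqβ vβ) , x) ,
                 Dumont132-≡ (trans (cong (λ l → glue (list l) β) ex) (sym (recompute-≡ s)))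
  where
  p : suc j + k ≡ m
  p = recompute-≡ℕ (double-injective (suc-injective (trans (sym (odd+even≡ j k)) (trans (cong₂ _+_ (sym eqα) (sym eqβ)) l))))

convolution↔even : ∀ m → Convolution Even132 Even132 m ↔ Even132 (suc m)
convolution↔even m = mk↔ (root-glue m) (root-glue-injective m) (root-glue-surjective m)

-- Ballot numbers

-- ballot (s + 1) m = (2m + s) C m − (2m + s) C (m − 1), see ballot-closed.
ballot : ℕ → ℕ → ℕ
ballot zero zero = 1
ballot zero (suc m) = 0
ballot (suc r) zero = ballot r zero
ballot (suc r) (suc m) = ballot r (suc m) + ballot (suc (suc r)) m

-- n C⁻ m is n C (m − 1), except that n C⁻ 0 = 0 rather than n C 0.
_C⁻_ : ℕ → ℕ → ℕ
n C⁻ zero = 0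
n C⁻ suc m = n C m

pascal⁻ : ∀ n m → suc n C m ≡ n C⁻ m + n C m
pascal⁻ n zero = refl
pascal⁻ n (suc m) = sym (nCk+nC[k+1]≡[n+1]C[k+1] n m)

ballot-zero : ∀ r → ballot r 0 ≡ 1
ballot-zero zero = refl
ballot-zero (suc r) = ballot-zero r

double≡+ : ∀ m → double m ≡ m + m
double≡+ m = trans (double≡2* m) (cong (m +_) (+-identityʳ m))

central-symmetric : ∀ m → suc (double m) C suc m ≡ suc (double m) C m
central-symmetric m = trans (nCk≡nC[n∸k] (s≤s (subst (m ≤_) (sym (double≡+ m)) (m≤m+n m m))))
                             (cong (suc (double m) C_) (trans (cong (_∸ m) (double≡+ m)) (m+n∸m≡n m m)))

ballot-closed : ∀ m s → ballot (suc s) m + (double m + s) C⁻ m ≡ (double m + s) C m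
ballot-closed zero s = cong (_+ 0) (ballot-zero (suc s))
ballot-closed (suc m) zero = begin
  ballot 2 m + (double (suc m) + 0) C m  ≡⟨ cong (λ z → ballot 2 m + z C m) (+-identityʳ (double (suc m))) ⟩
  ballot 2 m + suc n C m                  ≡⟨ cong (ballot 2 m +_) (pascal⁻ n m) ⟩
  ballot 2 m + (n C⁻ m + n C m)           ≡⟨ sym (+-assoc (ballot 2 m) _ _) ⟩
  (ballot 2 m + n C⁻ m) + n C m           ≡⟨ cong (_+ n C m) (subst (λ z → ballot 2 m + z C⁻ m ≡ z C m) (+-comm (double m) 1) (ballot-closed m 1)) ⟩
  n C m + n C m                           ≡⟨ cong (n C m +_) (sym (central-symmetric m)) ⟩
  n C m + n C suc m                       ≡⟨ nCk+nC[k+1]≡[n+1]C[k+1] n m ⟩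
  suc n C suc m                           ≡⟨ cong (_C suc m) (sym (+-identityʳ (double (suc m)))) ⟩
  (double (suc m) + 0) C suc m            ∎
  where
  open ≡-Reasoning
  n = suc (double m)
ballot-closed (suc m) (suc s) = begin
  (ballot (suc s) (suc m) + ballot (3 + s) m) + (double (suc m) + suc s) C⁻ suc m
    ≡⟨ cong (λ z → (ballot (suc s) (suc m) + ballot (3 + s) m) + z C m) (+-suc (double (suc m)) s) ⟩
  (ballot (suc s) (suc m) + ballot (3 + s) m) + suc n C m
    ≡⟨ cong (ballot (suc s) (suc m) + ballot (3 + s) m +_) (pascal⁻ n m) ⟩
  (ballot (suc s) (suc m) + ballot (3 + s) m) + (n C⁻ m + n C m)
    ≡⟨ interchange (ballot (suc s) (suc m)) (ballot (3 + s) m) (n C⁻ m) (n C m) ⟩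
  (ballot (suc s) (suc m) + n C⁻ suc m) + (ballot (3 + s) m + n C⁻ m)
    ≡⟨ cong₂ _+_ (ballot-closed (suc m) s) (subst (λ z → ballot (3 + s) m + z C⁻ m ≡ z C m) n≡ (ballot-closed m (2 + s))) ⟩
  n C suc m + n C m
    ≡⟨ +-comm (n C suc m) (n C m) ⟩
  n C m + n C suc m
    ≡⟨ nCk+nC[k+1]≡[n+1]C[k+1] n m ⟩
  suc n C suc m
    ≡⟨ cong (_C suc m) (sym (+-suc (double (suc m)) s)) ⟩
  (double (suc m) + suc s) C suc m ∎
  where
  open ≡-Reasoning
  n = double (suc m) + s
  interchange : ∀ a b c d → (a + b) + (c + d) ≡ (a + d) + (b + c)
  interchange = solve-∀
  n≡ : double m + (2 + s) ≡ n
  n≡ = trans (+-suc (double m) (suc s)) (cong suc (+-suc (double m) s))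

absorption : ∀ n j → suc j * (n C suc j) + j * (n C j) ≡ n * (n C j)
absorption zero zero = refl
absorption zero (suc j) = cong₂ _+_ (*-zeroʳ (suc (suc j))) (*-zeroʳ (suc j))
absorption (suc n) zero = trans (+-identityʳ _) (trans (*-identityˡ _) (trans (nC1≡n (suc n)) (sym (*-identityʳ (suc n)))))
absorption (suc n) (suc j) = begin
  suc (suc j) * (suc n C suc (suc j)) + suc j * (suc n C suc j)
    ≡⟨ cong₂ (λ x y → suc (suc j) * x + suc j * y) (sym (nCk+nC[k+1]≡[n+1]C[k+1] n (suc j))) (sym (nCk+nC[k+1]≡[n+1]C[k+1] n j)) ⟩
  suc (suc j) * (b + c) + suc j * (a + b)
    ≡⟨ regroup j a b c ⟩
  ((suc (suc j) * c + suc j * b) + (suc j * b + j * a)) + (a + b)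
    ≡⟨ cong (_+ (a + b)) (cong₂ _+_ (absorption n (suc j)) (absorption n j)) ⟩
  (n * b + n * a) + (a + b)
    ≡⟨ collect n a b ⟩
  suc n * (a + b)
    ≡⟨ cong (suc n *_) (nCk+nC[k+1]≡[n+1]C[k+1] n j) ⟩
  suc n * (suc n C suc j) ∎
  where
  open ≡-Reasoning
  a = n C j
  b = n C suc j
  c = n C suc (suc j)
  regroup : ∀ j a b c → suc (suc j) * (b + c) + suc j * (a + b) ≡ ((suc (suc j) * c + suc j * b) + (suc j * b + j * a)) + (a + b)
  regroup = solve-∀
  collect : ∀ n a b → (n * b + n * a) + (a + b) ≡ suc n * (a + b)
  collect = solve-∀

central : ∀ m → m * (double m C m) ≡ suc m * (double m C⁻ m)
central zero = refl
central (suc m) = sym (+-cancelʳ-≡ (m * a) _ _ (begin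
  suc (suc m) * a + m * a  ≡⟨ +-comm (suc (suc m) * a) (m * a) ⟩
  m * a + suc (suc m) * a  ≡⟨ sym (*-distribʳ-+ a m (suc (suc m))) ⟩
  (m + suc (suc m)) * a    ≡⟨ cong (_* a) n≡ ⟩
  n * a                    ≡⟨ sym (absorption n m) ⟩
  suc m * (n C suc m) + m * a ∎))
  where
  open ≡-Reasoning
  n = double (suc m)
  a = n C m
  n≡ : m + suc (suc m) ≡ n
  n≡ = trans (+-suc m (suc m)) (cong suc (trans (+-suc m m) (cong suc (sym (double≡+ m)))))

ballot-one : ∀ m → ballot 1 m * suc m ≡ double m C m
ballot-one m = +-cancelʳ-≡ (m * (double m C m)) _ _ (begin
  ballot 1 m * suc m + m * (double m C m)        ≡⟨ cong₂ _+_ (*-comm (ballot 1 m) (suc m)) (central m) ⟩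
  suc m * ballot 1 m + suc m * (double m C⁻ m)  ≡⟨ sym (*-distribˡ-+ (suc m) (ballot 1 m) _) ⟩
  suc m * (ballot 1 m + double m C⁻ m)          ≡⟨ cong (suc m *_) closed ⟩
  suc m * (double m C m)                        ∎)
  where
  open ≡-Reasoning
  closed : ballot 1 m + double m C⁻ m ≡ double m C m
  closed = subst (λ n → ballot 1 m + n C⁻ m ≡ n C m) (+-identityʳ (double m)) (ballot-closed m 0)

catalan≡ballot : ∀ m → catalan m ≡ ballot 1 m
catalan≡ballot m = begin
  ((2 * m) C m) / suc m          ≡⟨ cong (λ n → (n C m) / suc m) (sym (double≡2* m)) ⟩
  (double m C m) / suc m         ≡⟨ cong (_/ suc m) (sym (ballot-one m)) ⟩
  (ballot 1 m * suc m) / suc m   ≡⟨ m*n/n≡m (ballot 1 m) (suc m) ⟩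
  ballot 1 m                     ∎
  where open ≡-Reasoning

-- Counting Catalan families

-- Forests of r objects of total size m are counted by ballot numbers: the first object of a forest
-- is either the one of size 0 or splits into two.
module CatalanFamily (T : ℕ → Set) (t₀ : T 0) (T₀-unique : ∀ t → t ≡ t₀)
                     (split : ∀ m → Convolution T T m ↔ T (suc m)) where

  Forest : ℕ → ℕ → Set
  Forest zero m = m ≡ 0
  Forest (suc r) = Convolution T (Forest r)

  forest-zero : ∀ r → Forest r 0 ↔ Forest (suc r) 0
  forest-zero r = mk↔ₛ′ (λ f → 0 , 0 , refl , t₀ , f) from
    (λ { (zero , zero , refl , t , f) → cong (λ t → 0 , 0 , refl , t , f) (sym (T₀-unique t)) }) (λ _ → refl)
    where
    from : Forest (suc r) 0 → Forest r 0
    from (zero , zero , refl , _ , f) = f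

  module _ (r m : ℕ) where
    private
      module S (j : ℕ) = Inverse (split j)

      graft : ∀ j k → suc j + k ≡ suc m → Forest r k → Convolution T T j → Forest (suc (suc r)) m
      graft .(a + c) k p f (a , c , refl , s , t) = a , c + k , trans (sym (+-assoc a c k)) (suc-injective p) , s , (c , k , refl , t , f)

      to : Forest (suc r) (suc m) → Forest r (suc m) ⊎ Forest (suc (suc r)) m
      to (zero , .(suc m) , refl , _ , f) = inj₁ f
      to (suc j , k , p , t , f) = inj₂ (graft j k p f (S.from j t))

      from : Forest r (suc m) ⊎ Forest (suc (suc r)) m → Forest (suc r) (suc m)
      from (inj₁ f) = zero , suc m , refl , t₀ , f
      from (inj₂ (a , x , p , s , (c , k , q , t , f))) =
        suc (a + c) , k , cong suc (trans (+-assoc a c k) (trans (cong (a +_) q) p)) , S.to (a + c) (a , c , refl , s , t) , f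

      from-graft : ∀ j k (p : suc j + k ≡ suc m) (t : T (suc j)) f (c : Convolution T T j) → S.to j c ≡ t →
                   from (inj₂ (graft j k p f c)) ≡ (suc j , k , p , t , f)
      from-graft .(a + c) k p _ f (a , c , refl , s , t) refl = convolution-≡ refl refl

      from∘to : ∀ y → from (to y) ≡ y
      from∘to (zero , .(suc m) , refl , t , f) = cong (λ t → zero , suc m , refl , t , f) (sym (T₀-unique t))
      from∘to (suc j , k , p , t , f) = from-graft j k p t f (S.from j t) (S.strictlyInverseˡ j t)

      graft-from : ∀ a x (p : a + x ≡ m) s c k (q : c + k ≡ x) t f →
                   graft (a + c) k (cong suc (trans (+-assoc a c k) (trans (cong (a +_) q) p))) f (a , c , refl , s , t)
                     ≡ (a , x , p , s , (c , k , q , t , f))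
      graft-from a .(c + k) p s c k refl t f = convolution-≡ refl refl

      to∘from : ∀ z → to (from z) ≡ z
      to∘from (inj₁ f) = refl
      to∘from (inj₂ (a , x , p , s , (c , k , q , t , f))) =
        trans (cong (λ u → inj₂ (graft (a + c) k _ f u)) (S.strictlyInverseʳ (a + c) (a , c , refl , s , t)))
              (cong inj₂ (graft-from a x p s c k q t f))

    forest-suc : Forest (suc r) (suc m) ↔ (Forest r (suc m) ⊎ Forest (suc (suc r)) m)
    forest-suc = mk↔ₛ′ to from to∘from from∘to

  forest-count : ∀ r m → Fin (ballot r m) ↔ Forest r m
  forest-count zero zero = mk↔ₛ′ (λ _ → refl) (λ _ → fzero) (λ _ → ≡-irrelevant _ _) (λ { fzero → refl ; (fsuc ()) })
  forest-count zero (suc m) = mk↔ₛ′ (λ ()) (λ ()) (λ ()) (λ ())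
  forest-count (suc r) zero = ↔-trans (forest-count r zero) (forest-zero r)
  forest-count (suc r) (suc m) =
    ↔-trans +↔⊎ (↔-trans (forest-count r (suc m) ⊎-↔ forest-count (suc (suc r)) m) (↔-sym (forest-suc r m)))

  forest-one : ∀ m → Forest 1 m ↔ T m
  forest-one m = mk↔ₛ′ to (λ t → m , 0 , +-identityʳ m , t , refl)
    (λ t → cong (λ e → subst T e t) (≡-irrelevant _ refl)) from∘to
    where
    to : Forest 1 m → T m
    to (j , .0 , p , t , refl) = subst T (trans (sym (+-identityʳ j)) p) t
    from∘to : ∀ f → (m , 0 , +-identityʳ m , to f , refl) ≡ f
    from∘to (j , .0 , p , t , refl) = lemma (trans (sym (+-identityʳ j)) p) p
      where
      lemma : (q : j ≡ m) (p : j + 0 ≡ m) → (m , 0 , +-identityʳ m , subst T q t , refl) ≡ (j , 0 , p , t , refl)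
      lemma refl p = convolution-≡ refl refl

  catalan-count : ∀ m → Fin (catalan m) ↔ T m
  catalan-count m = subst (λ c → Fin c ↔ T m) (sym (catalan≡ballot m)) (↔-trans (forest-count 1 m) (forest-one m))

-- Vectors of Fin and lists of values

even⇒parity : ∀ x → Even x → parity x ≡ 0ℙ
even⇒parity x (divides q refl) = trans (ℙ.*-homo-* q 2) (ℙ.*-zeroʳ (parity q))

parity⇒even : ∀ x → parity x ≡ 0ℙ → Even x
parity⇒even x p with even-or-odd x
... | inj₁ (j , refl) = divides j (trans (double≡2* j) (*-comm 2 j))
... | inj₂ (j , refl) = ⊥-elim (0ℙ≢1ℙ (trans (sym p) (parity-suc-double j)))

odd⇒¬even : ∀ x → parity x ≡ 1ℙ → ¬ Even x
odd⇒¬even x p e = 0ℙ≢1ℙ (trans (sym (even⇒parity x e)) p)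

¬even⇒odd : ∀ x → ¬ Even x → parity x ≡ 1ℙ
¬even⇒odd x ¬e with parity-cases x
... | inj₁ even = ⊥-elim (¬e (parity⇒even x even))
... | inj₂ odd = odd

IsDumontFun : ∀ m → (Fin m → ℕ) → Set
IsDumontFun m f = ∀ (i : Fin m) →
  (Even (f i) → Σ (Fin m) λ j → (toℕ j ≡ suc (toℕ i)) × (f j < f i))
  × (¬ Even (f i) → (suc (toℕ i) ≡ m) ⊎ Σ (Fin m) λ j → (toℕ j ≡ suc (toℕ i)) × (f i < f j))

Avoids132Fun : ∀ m → (Fin m → ℕ) → Set
Avoids132Fun m f = ∀ (i j l : Fin m) → i Fin.< j → j Fin.< l → ¬ ((f i < f l) × (f l < f j))

dumontFun-tail : ∀ m f → IsDumontFun (suc m) f → IsDumontFun m (f ∘ fsuc)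
dumontFun-tail m f d i = descent , ascent
  where
  descent : Even (f (fsuc i)) → Σ (Fin m) λ j → (toℕ j ≡ suc (toℕ i)) × (f (fsuc j) < f (fsuc i))
  descent e with proj₁ (d (fsuc i)) e
  ... | fsuc j , eq , lt = j , suc-injective eq , lt
  ascent : ¬ Even (f (fsuc i)) → (suc (toℕ i) ≡ m) ⊎ Σ (Fin m) λ j → (toℕ j ≡ suc (toℕ i)) × (f (fsuc i) < f (fsuc j))
  ascent o with proj₂ (d (fsuc i)) o
  ... | inj₁ eq = inj₁ (suc-injective eq)
  ... | inj₂ (fsuc j , eq , lt) = inj₂ (j , suc-injective eq , lt)

dumontFun⇒list : ∀ m f → IsDumontFun m f → IsDumontList (tabulate f)
dumontFun⇒list zero f d = tt
dumontFun⇒list (suc zero) f d with parity-cases (f fzero)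
... | inj₂ odd = odd
... | inj₁ even with proj₁ (d fzero) (parity⇒even _ even)
...   | fzero , () , _
dumontFun⇒list (suc (suc m)) f d = first-step , dumontFun⇒list (suc m) (f ∘ fsuc) (dumontFun-tail (suc m) f d)
  where
  first-step : Step (parity (f fzero)) (f fzero) (f (fsuc fzero))
  first-step with parity-cases (f fzero)
  ... | inj₁ even with proj₁ (d fzero) (parity⇒even _ even)
  ...   | fsuc fzero , _ , lt = step-even⁺ even lt
  first-step | inj₂ odd with proj₂ (d fzero) (odd⇒¬even _ odd)
  ...   | inj₂ (fsuc fzero , _ , lt) = step-odd⁺ odd lt

dumontList⇒fun : ∀ m f → IsDumontList (tabulate f) → IsDumontFun m f
dumontList⇒fun (suc zero) f odd fzero = (λ e → ⊥-elim (odd⇒¬even _ odd e)) , (λ _ → inj₁ refl)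
dumontList⇒fun (suc (suc m)) f (s , d) fzero =
  (λ e → fsuc fzero , refl , step-even (even⇒parity _ e) s) , (λ o → inj₂ (fsuc fzero , refl , step-odd (¬even⇒odd _ o) s))
dumontList⇒fun (suc (suc m)) f (s , d) (fsuc i) with dumontList⇒fun (suc m) (f ∘ fsuc) d i
... | descent , ascent = (λ e → next (descent e)) , (λ o → Data.Sum.map (cong suc) next (ascent o))
  where
  next : ∀ {P : Fin (suc (suc m)) → Set} → Σ (Fin (suc m)) (λ j → toℕ j ≡ suc (toℕ i) × P (fsuc j)) →
         Σ (Fin (suc (suc m))) (λ j → toℕ j ≡ suc (toℕ (fsuc i)) × P j)
  next (j , eq , p) = fsuc j , cong suc eq , p

allPairs-tabulate⁻ : ∀ {A : Set} {R : A → A → Set} {m} {g : Fin m → A} →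
                     AllPairs R (tabulate g) → ∀ {i j} → i Fin.< j → R (g i) (g j)
allPairs-tabulate⁻ (px ∷ _) {fzero} {fsuc j} _ = All.tabulate⁻ px j
allPairs-tabulate⁻ (_ ∷ p) {fsuc i} {fsuc j} (s≤s i<j) = allPairs-tabulate⁻ p i<j

avoidsFun⇒list : ∀ m f → Avoids132Fun m f → Avoids132List (tabulate f)
avoidsFun⇒list zero f _ = tt
avoidsFun⇒list (suc m) f av =
  AllPairs.tabulate⁺-< (λ j<l → av fzero (fsuc _) (fsuc _) (s≤s z≤n) (s≤s j<l)) ,
  avoidsFun⇒list m (f ∘ fsuc) (λ i j l i<j j<l → av (fsuc i) (fsuc j) (fsuc l) (s≤s i<j) (s≤s j<l))

avoidsList⇒fun : ∀ m f → Avoids132List (tabulate f) → Avoids132Fun m f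
avoidsList⇒fun (suc m) f (no132 , _) fzero (fsuc j) (fsuc l) _ (s≤s j<l) = allPairs-tabulate⁻ no132 j<l
avoidsList⇒fun (suc m) f (_ , av) (fsuc i) (fsuc j) (fsuc l) (s≤s i<j) (s≤s j<l) = avoidsList⇒fun m (f ∘ fsuc) av i j l i<j j<l

unique⇒injective : ∀ m (f : Fin m → ℕ) → Unique (tabulate f) → ∀ i j → f i ≡ f j → i ≡ j
unique⇒injective m f u i j e with Fin.<-cmp i j
... | tri< i<j _ _ = ⊥-elim (allPairs-tabulate⁻ u i<j e)
... | tri≈ _ i≡j _ = i≡j
... | tri> _ _ j<i = ⊥-elim (allPairs-tabulate⁻ u j<i (sym e))

entries : ∀ {n m} → Vec (Fin n) m → List ℕ
entries v = Vec.toList (Vec.map (suc ∘ toℕ) v)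

entries-tabulate : ∀ {n m} (v : Vec (Fin n) m) → entries v ≡ tabulate (λ i → suc (toℕ (Vec.lookup v i)))
entries-tabulate [] = refl
entries-tabulate (x ∷ v) = cong (suc (toℕ x) ∷_) (entries-tabulate v)

length-entries : ∀ {n m} (v : Vec (Fin n) m) → length (entries v) ≡ m
length-entries [] = refl
length-entries (_ ∷ v) = cong suc (length-entries v)

entries-within : ∀ {n m} (v : Vec (Fin n) m) → All (Within 1 (suc n)) (entries v)
entries-within [] = []
entries-within (x ∷ v) = (s≤s z≤n , s≤s (Fin.toℕ<n x)) ∷ entries-within v

entries-injective : ∀ {n m} (u v : Vec (Fin n) m) → entries u ≡ entries v → u ≡ v
entries-injective [] [] _ = refl
entries-injective (x ∷ u) (y ∷ v) e =
  cong₂ _∷_ (Fin.toℕ-injective (suc-injective (∷-injectiveˡ e))) (entries-injective u v (∷-injectiveʳ e))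

within⇒pred< : ∀ {x n} → Within 1 (suc n) x → pred x < n
within⇒pred< (s≤s _ , s≤s x≤n) = x≤n

fromEntries : ∀ {n} m (xs : List ℕ) → .(length xs ≡ m) → .(All (Within 1 (suc n)) xs) → Vec (Fin n) m
fromEntries zero [] _ _ = []
fromEntries (suc m) (x ∷ xs) l w = fromℕ< (within⇒pred< (All.head w)) ∷ fromEntries m xs (suc-injective l) (All.tail w)
fromEntries zero (_ ∷ _) () _
fromEntries (suc m) [] () _

entries-fromEntries : ∀ {n} m xs .(l : length xs ≡ m) .(w : All (Within 1 (suc n)) xs) → entries (fromEntries m xs l w) ≡ xs
entries-fromEntries zero [] _ _ = refl
entries-fromEntries (suc m) (x ∷ xs) l w =
  cong₂ _∷_ (recompute-≡ℕ (suc-toℕ-fromℕ< (All.head w))) (entries-fromEntries m xs (suc-injective l) (All.tail w))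
  where
  suc-toℕ-fromℕ< : ∀ {x n} (w : Within 1 (suc n) x) → suc (toℕ (fromℕ< (within⇒pred< w))) ≡ x
  suc-toℕ-fromℕ< (s≤s _ , s≤s x≤n) = cong suc (Fin.toℕ-fromℕ< x≤n)
entries-fromEntries zero (_ ∷ _) () _
entries-fromEntries (suc m) [] () _

DP-≡ : ∀ {n k} {a b : DP n k} → DP.perm a ≡ DP.perm b → a ≡ b
DP-≡ {a = dp _ _ _ _ _} {dp _ _ _ _ _} refl = refl

DP⇒valid : ∀ {n} (v : Vec (Fin n) n) → IsPerm v → IsDumont v → Avoids132 v → IsDumont132 n (entries v)
DP⇒valid {n} v perm dumont avoids = record
  { length≡ = length-entries v
  ; within = entries-within v
  ; unique = subst Unique (sym (entries-tabulate v)) (Unique.tabulate⁺ (λ e → perm _ _ (Fin.toℕ-injective (suc-injective e))))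
  ; dumont = subst IsDumontList (sym (entries-tabulate v)) (dumontFun⇒list n (val v) dumont)
  ; avoids = subst Avoids132List (sym (entries-tabulate v)) (avoidsFun⇒list n (val v) avoids)
  }

module FromList {n} (xs : List ℕ) (v : IsDumont132 n xs) where

  V : Vec (Fin n) n
  V = fromEntries n xs (length≡ v) (within v)

  tabulate-V : tabulate (val V) ≡ xs
  tabulate-V = trans (sym (entries-tabulate V)) (entries-fromEntries n xs (length≡ v) (within v))

  isPerm : IsPerm V
  isPerm i j e = unique⇒injective n (val V) (subst Unique (sym tabulate-V) (unique v)) i j (cong (suc ∘ toℕ) e)

  isDumont : IsDumont V
  isDumont = dumontList⇒fun n (val V) (subst IsDumontList (sym tabulate-V) (dumont v))

  avoids132 : Avoids132 V
  avoids132 = avoidsList⇒fun n (val V) (subst Avoids132List (sym tabulate-V) (avoids v))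

  rises-V : rises V ≡ pred ⌈ n /2⌉
  rises-V = trans (cong risesL (entries-fromEntries n xs (length≡ v) (within v))) (rises-Dumont132 n xs v)

Dumont132↔DP : ∀ {n k} → k ≡ pred ⌈ n /2⌉ → Dumont132 n ↔ DP n k
Dumont132↔DP {n} {k} k≡ = mk↔ₛ′ to from
  (λ { (dp v _ _ _ _) → DP-≡ (entries-injective _ v (entries-fromEntries n (entries v) _ _)) })
  (λ { (d132 xs _) → Dumont132-≡ (entries-fromEntries n xs _ _) })
  where
  to : Dumont132 n → DP n k
  to (d132 xs v) = dp (fromEntries n xs (length≡ v) (within v))
    (FromList.isPerm xs v) (FromList.isDumont xs v) (FromList.avoids132 xs v) (trans (FromList.rises-V xs v) (sym k≡))
  from : DP n k → Dumont132 n
  from (dp v perm dumont avoids _) = d132 (entries v) (DP⇒valid v perm dumont avoids)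

DP-empty : ∀ n k → k ≢ pred ⌈ n /2⌉ → Fin 0 ↔ DP n k
DP-empty n k k≢ = mk↔ₛ′ (λ ()) (⊥-elim ∘ ¬DP) (⊥-elim ∘ ¬DP) (λ ())
  where
  ¬DP : DP n k → ⊥
  ¬DP (dp v perm dumont avoids r) = Irr.⊥-elim (k≢ (trans (sym r) (rises-Dumont132 n (entries v) (DP⇒valid v perm dumont avoids))))

even-count : ∀ m → Fin (catalan m) ↔ Dumont132 (double m)
even-count = CatalanFamily.catalan-count Even132 empty132 (λ x → Dumont132-zero-unique x empty132) convolution↔even

even-DP : ∀ m → Fin (catalan m) ↔ DP (double m) (pred m)
even-DP m = ↔-trans (even-count m) (Dumont132↔DP (cong pred (sym (⌈double/2⌉ m))))

odd-DP : ∀ m → Fin (catalan m) ↔ DP (suc (double m)) m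
odd-DP m = ↔-trans (↔-trans (even-count m) (even↔odd m)) (Dumont132↔DP (cong pred (sym (⌈suc-double/2⌉ m))))

length-from-rises : ∀ n k → 1 ≤ k → pred ⌈ n /2⌉ ≡ k → n ≡ 2 * k + 1 ⊎ n ≡ 2 * k + 2
length-from-rises n k 1≤k r with even-or-odd n
... | inj₁ (zero , refl) = ⊥-elim (<⇒≢ 1≤k r)
... | inj₁ (suc j , refl) = inj₂ (trans (cong (double ∘ suc) (trans (sym (⌈double/2⌉ j)) r)) (double-suc≡ k))
... | inj₂ (j , refl) = inj₁ (trans (cong (suc ∘ double) (trans (sym (cong pred (⌈suc-double/2⌉ j))) r)) (suc-double≡ k))

corollary2p12 : ((n : ℕ) → n ≤ 2 → Fin 1 ↔ DP n 0)
    × ((n : ℕ) → 2 < n → Fin 0 ↔ DP n 0)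
    × ((k : ℕ) → 1 ≤ k → Fin (catalan k) ↔ DP (2 * k + 1) k)
    × ((k : ℕ) → 1 ≤ k → Fin (catalan (suc k)) ↔ DP (2 * k + 2) k)
    × ((k n : ℕ) → 1 ≤ k → n ≢ 2 * k + 1 → n ≢ 2 * k + 2 → Fin 0 ↔ DP n k)
corollary2p12 =
  (λ { 0 _ → even-DP 0 ; 1 _ → odd-DP 0 ; 2 _ → even-DP 1 ; (suc (suc (suc _))) (s≤s (s≤s ())) }) ,
  (λ { (suc (suc (suc n))) _ → DP-empty _ 0 (λ ()) ; 0 () ; 1 (s≤s ()) ; 2 (s≤s (s≤s ())) }) ,
  (λ k _ → subst (λ n → Fin (catalan k) ↔ DP n k) (suc-double≡ k) (odd-DP k)) ,
  (λ k _ → subst (λ n → Fin (catalan (suc k)) ↔ DP n k) (double-suc≡ k) (even-DP (suc k))) ,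
  (λ k n 1≤k ≢odd ≢even → DP-empty n k (Data.Sum.[ ≢odd , ≢even ] ∘ length-from-rises n k 1≤k ∘ sym))
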